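{- Let $P$ and $Q$ be dMTSs over a common alphabet $A$ and let $R$ be a dMTS over $A$. (i) For every dMTS-witness $W$ of the conjunctive product $P\& Q$, $F\cap W=\emptyset$, where $F$ is the set of inconsistent states of $P\& Q$. (ii) The set $\{(p,q)\in P\times Q: \exists r\in R.\ r\sqsubseteq_{\mathrm{dMTS}} p \text{ and } r\sqsubseteq_{\mathrm{dMTS}} q\}$ is a dMTS-witness of $P\& Q$.
   Context: A disjunctive Modal Transition System (dMTS) is a tuple $(P,A,\longrightarrow_P,\dashrightarrow_P)$ with $P$ a set of states, $A$ an alphabet not containing the silent action $\tau$, a must-transition relation $\longrightarrow_P\subseteq P\times A\times(2^P\setminus\{\emptyset\})$ and a may-transition relation $\dashrightarrow_P\subseteq P\times(A\cup\{\tau\})\times P$, satisfying syntactic consistency: $p\xrightarrow{a}P'$ (must) implies $p\stackrel{a}{\dashrightarrow}p'$ (may) for all $p'\in P'$. Write $p\xrightarrow{a}$ if $p\xrightarrow{a}P'$ for some $P'$. Weak may-transitions: $p\stackrel{\epsilon}{\Longrightarrow}p'$ iff $p(\stackrel{\tau}{\dashrightarrow})^*p'$; for $\alpha\in A\cup\{\tau\}$, $p\stackrel{\alpha}{\Longrightarrow}p'$ iff there is $p''$ with $p\stackrel{\epsilon}{\Longrightarrow}p''\stackrel{\alpha}{\dashrightarrow}p'$; $p\stackrel{\alpha}{\Longrightarrow}$ means such $p'$ exists. $\hat\alpha=\epsilon$ if $\alpha=\tau$, else $\hat\alpha=\alpha$. For dMTSs $P,Q$ over $A$, $\mathcal R\subseteq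 P\times Q$ is an observational modal refinement relation if for all $(p,q)\in\mathcal R$: (i) $q\xrightarrow{a}Q'$ implies there is $P'$ with $p\xrightarrow{a}P'$ and for every $p'\in P'$ some $q'\in Q'$ with $(p',q')\in\mathcal R$; (ii) $p\stackrel{\alpha}{\dashrightarrow}p'$ implies there is $q'$ with $q\stackrel{\hat\alpha}{\Longrightarrow}q'$ and $(p',q')\in\mathcal R$. $p\sqsubseteq_{\mathrm{dMTS}}q$ iff some such relation contains $(p,q)$. Conjunctive product $P\& Q$: state set $P\times Q$, alphabet $A$, with (Must1) $(p,q)\xrightarrow{a}\{(p',q'): p'\in P', q\stackrel{a}{\Longrightarrow}_Qq'\}$ if $p\xrightarrow{a}_PP'$ and $q\stackrel{a}{\Longrightarrow}_Q$; (Must2) $(p,q)\xrightarrow{a}\{(p',q'): p\stackrel{a}{\Longrightarrow}_Pp', q'\in Q'\}$ if $p\stackrel{a}{\Longrightarrow}_P$ and $q\xrightarrow{a}_QQ'$; (May1) $(p,q)\stackrel{\tau}{\dashrightarrow}(p',q)$ if $p\stackrel{\tau}{\Longrightarrow}_Pp'$; (May2) $(p,q)\stackrel{\tau}{\dashrightarrow}(p,q')$ if $q\stackrel{\tau}{\Longrightarrow}_Qq'$; (May3) $(p,q)\stackrel{\alpha}{\dashrightarrow}(p',q')$ if $p\stackrel{\alpha}{\Longrightarrow}_Pp'$ and $q\stackrel{\alpha}{\Longrightarrow}_Qq'$. The set $F\subseteq P\times Q$ of inconsistent states is the least set with: (F1) $p\xrightarrow{a}_P$ and not $q\stackrel{a}{\Longrightarrow}_Q$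 imply $(p,q)\in F$; (F2) not $p\stackrel{a}{\Longrightarrow}_P$ and $q\xrightarrow{a}_Q$ imply $(p,q)\in F$; (F3) $(p,q)\xrightarrow{a}R'$ in $P\& Q$ with $R'\subseteq F$ implies $(p,q)\in F$. A dMTS-witness of $P\& Q$ is a set $W\subseteq P\times Q$ such that for all $(p,q)\in W$: (W1) $p\xrightarrow{a}_P$ implies $q\stackrel{a}{\Longrightarrow}_Q$; (W2) $q\xrightarrow{a}_Q$ implies $p\stackrel{a}{\Longrightarrow}_P$; (W3) $(p,q)\xrightarrow{a}R'$ in $P\& Q$ implies $R'\cap W\neq\emptyset$. -}

module Defs where

open import Level using (Level; _⊔_) renaming (suc to lsuc; zero to lzero)
open import Data.Product using (Σ; ∃; ∃-syntax; _×_; _,_; proj₁; proj₂)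
open import Data.Empty using (⊥)
open import Relation.Nullary using (¬_)
open import Relation.Binary.Construct.Closure.ReflexiveTransitive using (Star; ε; _◅_)

data Act (A : Set) : Set where
  τ   : Act A
  act : A → Act A

Subset : Set → Set₁
Subset S = S → Set

record DMTS (A : Set) : Set₁ where
  field
    State : Set
    must  : State → A → Subset State → Set
    may   : State → Act A → State → Set
    must-nonempty : ∀ {p a P'} → must p a P' → ∃[ p' ] P' p'
    consistent : ∀ {p a P' p'} → must p a P' → P' p' → may p (act a) p'

  HasMust : State → A → Set₁
  HasMust p a = ∃[ P' ] must p a P'

  WeakEps : State → State → Set
  WeakEps = Star (λ p p' → may p τ p')

  Weak : State → Act A → State → Set
  Weak p α p' = ∃[ p'' ] (WeakEps p p'' × may p'' α p')

  HasWeak : State → Act A → Set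
  HasWeak p α = ∃[ p' ] Weak p α p'

  WeakHat : State → Act A → State → Set
  WeakHat p τ       p' = WeakEps p p'
  WeakHat p (act a) p' = Weak p (act a) p'

open DMTS public

module _ {A : Set} (P Q : DMTS A) where
  private
    module P = DMTS P
    module Q = DMTS Q

  record IsRefinement (ℛ : P.State → Q.State → Set) : Set₁ where
    field
      must-sim : ∀ {p q a Q'} → ℛ p q → Q.must q a Q' →
                 ∃[ P' ] (P.must p a P' × (∀ p' → P' p' → ∃[ q' ] (Q' q' × ℛ p' q')))
      may-sim  : ∀ {p q α p'} → ℛ p q → P.may p α p' →
                 ∃[ q' ] (Q.WeakHat q α q' × ℛ p' q')

  _⊑_ : P.State → Q.State → Set₁
  p ⊑ q = ∃[ ℛ ] (IsRefinement ℛ × ℛ p q)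

module _ {A : Set} (P Q : DMTS A) where
  private
    module P = DMTS P
    module Q = DMTS Q

  PQ : Set
  PQ = P.State × Q.State

  data ProdMustRule : PQ → A → Set₁ where
    must1 : ∀ {p q a P'} → P.must p a P' → Q.HasWeak q (act a) → ProdMustRule (p , q) a
    must2 : ∀ {p q a Q'} → P.HasWeak p (act a) → Q.must q a Q' → ProdMustRule (p , q) a

  ruleTarget : ∀ {s a} → ProdMustRule s a → Subset PQ
  ruleTarget (must1 {q = q} {a = a} {P' = P'} _ _) (p' , q') = P' p' × Q.Weak q (act a) q'
  ruleTarget (must2 {p = p} {a = a} {Q' = Q'} _ _) (p' , q') = P.Weak p (act a) p' × Q' q'

  prodMust : PQ → A → Subset PQ → Set₁
  prodMust s a R' = Σ (ProdMustRule s a) λ t → (∀ r → R' r → ruleTarget t r) × (∀ r → ruleTarget t r → R' r)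

  data prodMay : PQ → Act A → PQ → Set where
    may1 : ∀ {p q p'} → P.Weak p τ p' → prodMay (p , q) τ (p' , q)
    may2 : ∀ {p q q'} → Q.Weak q τ q' → prodMay (p , q) τ (p , q')
    may3 : ∀ {p q p' q' α} → P.Weak p α p' → Q.Weak q α q' → prodMay (p , q) α (p' , q')

  data Inconsistent : PQ → Set₁ where
    F1 : ∀ {p q a} → P.HasMust p a → ¬ Q.HasWeak q (act a) → Inconsistent (p , q)
    F2 : ∀ {p q a} → ¬ P.HasWeak p (act a) → Q.HasMust q a → Inconsistent (p , q)
    F3 : ∀ {s a R'} → prodMust s a R' → (∀ r → R' r → Inconsistent r) → Inconsistent s

  record IsWitness {ℓ : Level} (W : PQ → Set ℓ) : Set (lsuc lzero ⊔ ℓ) where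
    field
      W1 : ∀ {p q a} → W (p , q) → P.HasMust p a → Q.HasWeak q (act a)
      W2 : ∀ {p q a} → W (p , q) → Q.HasMust q a → P.HasWeak p (act a)
      W3 : ∀ {s a R'} → W s → prodMust s a R' → ∃[ r ] (R' r × W r)

-- (i) A witness state can never be derived inconsistent: (F1) and (F2) are excluded by
-- (W1) and (W2), and (F3) is excluded by induction, since (W3) keeps some successor in W.
-- (ii) If r refines both p and q, a must-transition of p is matched by one of r (must-
-- simulation into p), whose nonempty target contains some r'; r' refines a state of the
-- target in p, and the may-transition r --a--> r' is matched weakly in q (may-simulation
-- into q). So (p, q) moves to a state of the product's target that is again commonly refined.
module Submission where

open import Defs
open import Level using (Level)
open import Data.Product using (_×_; _,_; ∃-syntax; ∃₂; proj₁; proj₂)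
open import Data.Empty using (⊥)

witness-disjoint-inconsistent : {A : Set} {ℓ : Level} (P Q : DMTS A)
  (W : PQ P Q → Set ℓ) → IsWitness P Q W → ∀ s → Inconsistent P Q s → W s → ⊥
witness-disjoint-inconsistent P Q W isW s (F1 must nw) w = nw (IsWitness.W1 isW w must)
witness-disjoint-inconsistent P Q W isW s (F2 nw must) w = nw (IsWitness.W2 isW w must)
witness-disjoint-inconsistent P Q W isW s (F3 must R'⊆F) w
  with IsWitness.W3 isW w must
... | r , r∈R' , wr = witness-disjoint-inconsistent P Q W isW r (R'⊆F r r∈R') wr

module _ {A : Set} (R X : DMTS A) where

  ⊑-must : ∀ {r x a X'} → _⊑_ R X r x → must X x a X' →
           ∃[ R' ] (must R r a R' × (∀ r' → R' r' → ∃[ x' ] (X' x' × _⊑_ R X r' x')))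
  ⊑-must (ℛ , isRef , rℛx) m with IsRefinement.must-sim isRef rℛx m
  ... | R' , r-must , sim = R' , r-must , λ r' r'∈R' →
    let (x' , x'∈X' , r'ℛx') = sim r' r'∈R' in x' , x'∈X' , ℛ , isRef , r'ℛx'

  ⊑-may : ∀ {r x α r'} → _⊑_ R X r x → may R r α r' →
          ∃[ x' ] (WeakHat X x α x' × _⊑_ R X r' x')
  ⊑-may (ℛ , isRef , rℛx) m with IsRefinement.may-sim isRef rℛx m
  ... | x' , x⇒x' , r'ℛx' = x' , x⇒x' , ℛ , isRef , r'ℛx'

module _ {A : Set} (R X Y : DMTS A) where

  CommonlyRefined : State X → State Y → Set₁
  CommonlyRefined x y = ∃[ r ] (_⊑_ R X r x × _⊑_ R Y r y)

  commonlyRefined-must : ∀ {x y a X'} → CommonlyRefined x y → must X x a X' →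
    ∃₂ λ x' y' → X' x' × Weak Y y (act a) y' × CommonlyRefined x' y'
  commonlyRefined-must (r , r⊑x , r⊑y) m with ⊑-must R X r⊑x m
  ... | R' , r-must , sim with must-nonempty R r-must
  ... | r' , r'∈R' with sim r' r'∈R' | ⊑-may R Y r⊑y (consistent R r-must r'∈R')
  ... | x' , x'∈X' , r'⊑x' | y' , y⇒y' , r'⊑y' =
    x' , y' , x'∈X' , y⇒y' , r' , r'⊑x' , r'⊑y'

  commonlyRefined-weak : ∀ {x y a} → CommonlyRefined x y →
                         HasMust X x a → HasWeak Y y (act a)
  commonlyRefined-weak xy (X' , m) =
    let (_ , y' , _ , y⇒y' , _) = commonlyRefined-must xy m in y' , y⇒y'

commonlyRefined-sym : {A : Set} (R X Y : DMTS A) {x : State X} {y : State Y} →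
  CommonlyRefined R X Y x y → CommonlyRefined R Y X y x
commonlyRefined-sym R X Y (r , r⊑x , r⊑y) = r , r⊑y , r⊑x

commonlyRefined-witness : {A : Set} (P Q R : DMTS A) →
  IsWitness P Q (λ s → CommonlyRefined R P Q (proj₁ s) (proj₂ s))
commonlyRefined-witness P Q R = record
  { W1 = commonlyRefined-weak R P Q
  ; W2 = λ pq → commonlyRefined-weak R Q P (commonlyRefined-sym R P Q pq)
  ; W3 = W3
  }
  where
  W3 : ∀ {s a R'} → CommonlyRefined R P Q (proj₁ s) (proj₂ s) → prodMust P Q s a R' →
       ∃[ s' ] (R' s' × CommonlyRefined R P Q (proj₁ s') (proj₂ s'))
  W3 pq (must1 m _ , _ , target⊆R') with commonlyRefined-must R P Q pq m
  ... | p' , q' , p'∈P' , q⇒q' , r' , r'⊑p' , r'⊑q' =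
    (p' , q') , target⊆R' (p' , q') (p'∈P' , q⇒q') , r' , r'⊑p' , r'⊑q'
  W3 pq (must2 _ m , _ , target⊆R')
    with commonlyRefined-must R Q P (commonlyRefined-sym R P Q pq) m
  ... | q' , p' , q'∈Q' , p⇒p' , r' , r'⊑q' , r'⊑p' =
    (p' , q') , target⊆R' (p' , q') (p⇒p' , q'∈Q') , r' , r'⊑p' , r'⊑q'

lemma3p7 : {A : Set} {ℓ : Level} (P Q R : DMTS A) →
    (∀ (W : PQ P Q → Set ℓ) → IsWitness P Q W →
       ∀ s → Inconsistent P Q s → W s → ⊥)
    × IsWitness P Q (λ s → ∃[ r ] (_⊑_ R P r (proj₁ s) × _⊑_ R Q r (proj₂ s)))
lemma3p7 P Q R = witness-disjoint-inconsistent P Q , commonlyRefined-witness P Q R
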